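{- Let $n\ge5$ and $s$ be integers with $1<s<n/2$. Then $$\pi(C_n(1,s))\ge \frac{\lfloor n/2\rfloor\lceil n/2\rceil}{s+1}=\frac{n^2-\epsilon(n)}{4(s+1)},$$ where $\epsilon(n)=1$ if $n$ is odd and $\epsilon(n)=0$ if $n$ is even.
   Context: The circulant graph $C_n(1,s)$ has vertex set $\mathbb{Z}_n$, with $i,j$ adjacent iff $i-j\in\{\pm1,\pm s\}$ mod $n$. An all-to-all routing $R$ of a graph $G$ is a set of oriented paths with exactly one path from $x$ to $y$ for each ordered pair of distinct vertices. The load of an edge is the number of paths of $R$ using it in either direction; $\pi(G,R)$ is the maximum edge load and $\pi(G)=\min_R\pi(G,R)$ is the edge-forwarding index. -}

module Defs where

open import Data.Nat using (ℕ; zero; suc; _+_; _*_; _∸_; _≤_; _<_)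
open import Data.Nat.DivMod using (_%_; _/_)
open import Data.Fin using (Fin; toℕ)
open import Data.Fin.Properties using () renaming (_≟_ to _≟F_)
open import Data.Product using (_×_; _,_; Σ; ∃)
open import Data.Product.Properties using (≡-dec)
open import Data.Sum using (_⊎_)
open import Data.List using (List; []; _∷_; length; filter; allFin; cartesianProduct)
open import Data.List.Relation.Unary.Unique.Propositional using (Unique)
open import Data.List.Membership.Propositional using (_∈_)
import Data.List.Membership.DecPropositional as DecMem
open import Relation.Binary.PropositionalEquality using (_≡_; _≢_)
open import Relation.Nullary using (Dec; ¬?)
open import Relation.Nullary.Decidable using (_×-dec_; _⊎-dec_)

diff : (n : ℕ) → Fin n → Fin n → ℕ
diff zero ()
diff (suc m) u v = (toℕ u + (suc m ∸ toℕ v)) % suc m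

Adj : (n s : ℕ) → Fin n → Fin n → Set
Adj n s u v = diff n u v ≡ 1 ⊎ diff n u v ≡ n ∸ 1 ⊎ diff n u v ≡ s ⊎ diff n u v ≡ n ∸ s

data Walk (n s : ℕ) : Fin n → Fin n → List (Fin n) → Set where
  stop : ∀ {x} → Walk n s x x (x ∷ [])
  step : ∀ {u v y p} → Adj n s u v → Walk n s v y p → Walk n s u y (u ∷ p)

IsPath : (n s : ℕ) → Fin n → Fin n → List (Fin n) → Set
IsPath n s x y p = Walk n s x y p × Unique p

-- all-to-all routing: one oriented path from x to y for each ordered pair x ≠ y
-- (the value of route x x is irrelevant)
record Routing (n s : ℕ) : Set where
  field
    route : Fin n → Fin n → List (Fin n)
    valid : ∀ x y → x ≢ y → IsPath n s x y (route x y)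
open Routing public

steps : ∀ {A : Set} → List A → List (A × A)
steps [] = []
steps (x ∷ []) = []
steps (x ∷ y ∷ p) = (x , y) ∷ steps (y ∷ p)

Uses : ∀ {n} → Fin n → Fin n → List (Fin n) → Set
Uses u v p = (u , v) ∈ steps p ⊎ (v , u) ∈ steps p

uses? : ∀ {n} (u v : Fin n) (p : List (Fin n)) → Dec (Uses u v p)
uses? {n} u v p = (u , v) ∈? steps p ⊎-dec (v , u) ∈? steps p
  where open DecMem (≡-dec _≟F_ _≟F_)

load : ∀ {n s} → Routing n s → Fin n → Fin n → ℕ
load {n} R u v =
  length (filter (λ (xy : Fin n × Fin n) →
                    let x = Data.Product.proj₁ xy ; y = Data.Product.proj₂ xy in
                    ¬? (x ≟F y) ×-dec uses? u v (route R x y))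
                 (cartesianProduct (allFin n) (allFin n)))

ε : ℕ → ℕ
ε n = n % 2

⌈_/2⌉ : ℕ → ℕ
⌈ n /2⌉ = (n + 1) / 2

-- Cut the cycle 0, 1, …, n-1 into the arcs A = [0, h) and B = [h, n) with h = ⌊n/2⌋.  Each of
-- the 2·|A|·|B| ordered pairs separated by the cut is routed through an edge joining A and B,
-- and there are at most 2s + 2 such edges: the 1-edges {h-1, h} and {0, n-1}, the s-edges
-- {b-s, b} with h ≤ b < h+s, and the wrapping s-edges {a, a+n-s} with a < s.  Hence one of them
-- carries at least 2·|A|·|B| / (2s + 2) = ⌊n/2⌋⌈n/2⌉ / (s + 1) paths.
module Submission where

open import Defs
open import Data.Nat using (ℕ; zero; suc; _+_; _*_; _∸_; _≤_; _<_; _⊓_; z≤n; s≤s; _<?_; _≤?_; _≟_; ⌊_/2⌋; NonZero; >-nonZero⁻¹)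
open import Data.Nat.Properties
open import Data.Nat.ListAction using (sum)
open import Data.Nat.Tactic.RingSolver using (solve-∀)
open import Data.List using (List; []; _∷_; [_]; _++_; length; filter; map; cartesianProduct; tabulate; allFin; upTo; applyUpTo)
open import Data.List.Properties using (filter-++; length-filter; length-++; length-map; length-upTo; length-tabulate; filter-all; filter-none; filter-accept; filter-reject; map-tabulate; map-upTo; upTo-∷ʳ)
open import Data.List.Relation.Unary.All using (universal)
open import Data.List.Relation.Unary.Any as Any using (Any; here; there; any?)
open import Data.List.Membership.Propositional using (_∈_; lose)
open import Data.List.Membership.Propositional.Properties using (∈-map⁺; ∈-++⁺ˡ; ∈-++⁺ʳ; ∈-upTo⁺; ∈-filter⁺; ∈-filter⁻)
open import Data.Fin using (Fin; toℕ)
open import Data.Fin.Properties using (toℕ<n; toℕ-injective; toℕ-fromℕ<) renaming (_≟_ to _≟F_)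
open import Data.Nat.DivMod using (_/_; _%_; _mod_; +-distrib-/; m≥n⇒m/n>0; m/n<m; m<n⇒m%n≡m; [m+n]%n≡m%n; m%n<n)
open import Data.Product using (_×_; _,_; proj₁; proj₂; ∃; ∃₂)
open import Data.Sum using (_⊎_; inj₁; inj₂)
open import Function using (_∘_; id)
open import Relation.Nullary using (Dec; yes; no; ¬_; ¬?; contradiction)
open import Relation.Nullary.Decidable using (_×-dec_; _⊎-dec_; decidable-stable)
open import Level using (0ℓ)
open import Relation.Unary using (Pred; Decidable; ∁; _⊆_; _∪_; _∩_; _⟨×⟩_; Empty; Universal)
open import Relation.Unary.Properties using (∁?; _∪?_; _∩?_; _×?_)
open import Relation.Binary.PropositionalEquality using (_≡_; _≢_; refl; sym; trans; cong; cong₂; subst; subst₂; module ≡-Reasoning)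
open import Relation.Binary using (tri<; tri≈; tri>)

count : {A : Set} {P : Pred A 0ℓ} → Decidable P → List A → ℕ
count P? xs = length (filter P? xs)

module _ {A : Set} {P Q : Pred A 0ℓ} (P? : Decidable P) (Q? : Decidable Q) where

  count-mono : P ⊆ Q → ∀ xs → count P? xs ≤ count Q? xs
  count-mono P⊆Q [] = z≤n
  count-mono P⊆Q (x ∷ xs) with P? x | Q? x
  ... | yes _  | yes _  = s≤s (count-mono P⊆Q xs)
  ... | yes px | no ¬qx = contradiction (P⊆Q px) ¬qx
  ... | no _   | yes _  = m≤n⇒m≤1+n (count-mono P⊆Q xs)
  ... | no _   | no _   = count-mono P⊆Q xs

  count-∪+count-∩ : ∀ xs → count (P? ∪? Q?) xs + count (P? ∩? Q?) xs ≡ count P? xs + count Q? xs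
  count-∪+count-∩ [] = refl
  count-∪+count-∩ (x ∷ xs) with P? x | Q? x
  ... | yes _ | yes _ = cong suc (trans (+-suc _ _) (trans (cong suc (count-∪+count-∩ xs)) (sym (+-suc _ _))))
  ... | yes _ | no _  = cong suc (count-∪+count-∩ xs)
  ... | no _  | yes _ = trans (cong suc (count-∪+count-∩ xs)) (sym (+-suc _ _))
  ... | no _  | no _  = count-∪+count-∩ xs

module _ {A : Set} {P : Pred A 0ℓ} (P? : Decidable P) where

  count-none : Empty P → ∀ xs → count P? xs ≡ 0
  count-none ∅ xs = cong length (filter-none P? (universal ∅ xs))

  count-all : Universal P → ∀ xs → count P? xs ≡ length xs
  count-all u xs = cong length (filter-all P? (universal u xs))

  count-++ : ∀ xs ys → count P? (xs ++ ys) ≡ count P? xs + count P? ys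
  count-++ xs ys = trans (cong length (filter-++ P? xs ys)) (length-++ (filter P? xs))

  count-map : {B : Set} (f : B → A) → ∀ xs → count P? (map f xs) ≡ count (P? ∘ f) xs
  count-map f [] = refl
  count-map f (x ∷ xs) with P? (f x)
  ... | yes _ = cong suc (count-map f xs)
  ... | no _  = count-map f xs

module _ {A : Set} {P Q : Pred A 0ℓ} (P? : Decidable P) (Q? : Decidable Q) where

  count-cong : P ⊆ Q → Q ⊆ P → ∀ xs → count P? xs ≡ count Q? xs
  count-cong P⊆Q Q⊆P xs = ≤-antisym (count-mono P? Q? P⊆Q xs) (count-mono Q? P? Q⊆P xs)

  count-∪-≤ : ∀ xs → count (P? ∪? Q?) xs ≤ count P? xs + count Q? xs
  count-∪-≤ xs = m+n≤o⇒m≤o _ (≤-reflexive (count-∪+count-∩ P? Q? xs))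

  count-disjoint-∪ : Empty (P ∩ Q) → ∀ xs → count (P? ∪? Q?) xs ≡ count P? xs + count Q? xs
  count-disjoint-∪ ∅ xs = begin
    count (P? ∪? Q?) xs                             ≡⟨ +-identityʳ _ ⟨
    count (P? ∪? Q?) xs + 0                         ≡⟨ cong (count (P? ∪? Q?) xs +_) (count-none (P? ∩? Q?) ∅ xs) ⟨
    count (P? ∪? Q?) xs + count (P? ∩? Q?) xs       ≡⟨ count-∪+count-∩ P? Q? xs ⟩
    count P? xs + count Q? xs                       ∎
    where open ≡-Reasoning

count+count-∁ : {A : Set} {P : Pred A 0ℓ} (P? : Decidable P) → ∀ xs → count P? xs + count (∁? P?) xs ≡ length xs
count+count-∁ {P = P} P? xs = begin
  count P? xs + count (∁? P?) xs                   ≡⟨ count-disjoint-∪ P? (∁? P?) (λ _ (p , ¬p) → ¬p p) xs ⟨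
  count (P? ∪? ∁? P?) xs                           ≡⟨ count-all (P? ∪? ∁? P?) excluded-middle xs ⟩
  length xs                                        ∎
  where
  open ≡-Reasoning
  excluded-middle : Universal (P ∪ ∁ P)
  excluded-middle x with P? x
  ... | yes p = inj₁ p
  ... | no ¬p = inj₂ ¬p

count-cartesianProduct : {A B : Set} {P : Pred A 0ℓ} {Q : Pred B 0ℓ} (P? : Decidable P) (Q? : Decidable Q) →
  ∀ xs ys → count (P? ×? Q?) (cartesianProduct xs ys) ≡ count P? xs * count Q? ys
count-cartesianProduct P? Q? [] ys = refl
count-cartesianProduct P? Q? (x ∷ xs) ys = begin
  count (P? ×? Q?) (map (x ,_) ys ++ cartesianProduct xs ys)                    ≡⟨ count-++ (P? ×? Q?) (map (x ,_) ys) _ ⟩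
  count (P? ×? Q?) (map (x ,_) ys) + count (P? ×? Q?) (cartesianProduct xs ys)  ≡⟨ cong₂ _+_ (count-map (P? ×? Q?) (x ,_) ys)
                                                                                              (count-cartesianProduct P? Q? xs ys) ⟩
  count ((P? ×? Q?) ∘ (x ,_)) ys + count P? xs * count Q? ys                     ≡⟨ row ⟩
  count P? (x ∷ xs) * count Q? ys                                                ∎
  where
  open ≡-Reasoning
  row : count ((P? ×? Q?) ∘ (x ,_)) ys + count P? xs * count Q? ys ≡ count P? (x ∷ xs) * count Q? ys
  row with P? x
  ... | yes px = cong (_+ _) (count-cong _ Q? proj₂ (px ,_) ys)
  ... | no ¬px = cong (_+ _) (count-none _ (λ _ → ¬px ∘ proj₁) ys)

union-bound : {A E : Set} {R : E → Pred A 0ℓ} (R? : ∀ e → Decidable (R e)) →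
  ∀ es xs → count (λ x → any? (λ e → R? e x) es) xs ≤ sum (map (λ e → count (R? e) xs) es)
union-bound R? [] xs = ≤-reflexive (count-none _ (λ _ ()) xs)
union-bound R? (e ∷ es) xs = begin
  count (λ x → any? (λ e → R? e x) (e ∷ es)) xs                 ≤⟨ count-mono _ (R? e ∪? inEs?) Any.toSum xs ⟩
  count (R? e ∪? inEs?) xs                                     ≤⟨ count-∪-≤ (R? e) inEs? xs ⟩
  count (R? e) xs + count inEs? xs                             ≤⟨ +-monoʳ-≤ (count (R? e) xs) (union-bound R? es xs) ⟩
  count (R? e) xs + sum (map (λ e → count (R? e) xs) es)       ∎
  where
  open ≤-Reasoning
  inEs? = λ x → any? (λ e → R? e x) es

some-≥-average : {E : Set} (f : E → ℕ) → ∀ es → 0 < sum (map f es) → ∃ λ e → e ∈ es × sum (map f es) ≤ length es * f e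
some-≥-average f (e ∷ es) _ = maximal e es
  where
  maximal : ∀ e es → ∃ λ m → m ∈ e ∷ es × sum (map f (e ∷ es)) ≤ length (e ∷ es) * f m
  maximal e [] = e , here refl , ≤-refl
  maximal e (e′ ∷ es) with maximal e′ es
  ... | m , m∈ , bound with f e ≤? f m
  ...   | yes fe≤fm = m , there m∈ , +-mono-≤ fe≤fm bound
  ...   | no  fe≰fm = e , here refl , +-monoʳ-≤ (f e) (≤-trans bound (*-monoʳ-≤ (length (e′ ∷ es)) (<⇒≤ (≰⇒> fe≰fm))))

count-<-upTo : ∀ h n → count (_<? h) (upTo n) ≡ h ⊓ n
count-<-upTo h zero = sym (⊓-zeroʳ h)
count-<-upTo h (suc n) = begin
  count (_<? h) (upTo (suc n))                   ≡⟨ cong (count (_<? h)) (upTo-∷ʳ n) ⟨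
  count (_<? h) (upTo n ++ [ n ])                ≡⟨ count-++ (_<? h) (upTo n) [ n ] ⟩
  count (_<? h) (upTo n) + count (_<? h) [ n ]   ≡⟨ cong (_+ count (_<? h) [ n ]) (count-<-upTo h n) ⟩
  h ⊓ n + count (_<? h) [ n ]                    ≡⟨ last-step ⟩
  h ⊓ suc n                                      ∎
  where
  open ≡-Reasoning
  last-step : h ⊓ n + count (_<? h) [ n ] ≡ h ⊓ suc n
  last-step with n <? h
  ... | yes n<h = begin
    h ⊓ n + count (_<? h) [ n ]  ≡⟨ cong₂ _+_ (m≥n⇒m⊓n≡n (<⇒≤ n<h)) (cong length (filter-accept (_<? h) n<h)) ⟩
    n + 1                        ≡⟨ +-comm n 1 ⟩
    suc n                        ≡⟨ m≥n⇒m⊓n≡n n<h ⟨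
    h ⊓ suc n                    ∎
  ... | no  n≮h = begin
    h ⊓ n + count (_<? h) [ n ]  ≡⟨ cong₂ _+_ (m≤n⇒m⊓n≡m (≮⇒≥ n≮h)) (cong length (filter-reject (_<? h) n≮h)) ⟩
    h + 0                        ≡⟨ +-identityʳ h ⟩
    h                            ≡⟨ m≤n⇒m⊓n≡m (m≤n⇒m≤1+n (≮⇒≥ n≮h)) ⟨
    h ⊓ suc n                    ∎

tabulate-toℕ : ∀ n → tabulate {n = n} toℕ ≡ upTo n
tabulate-toℕ zero = refl
tabulate-toℕ (suc n) = cong (0 ∷_) (begin
  tabulate (suc ∘ toℕ)      ≡⟨ map-tabulate toℕ suc ⟨
  map suc (tabulate toℕ)    ≡⟨ cong (map suc) (tabulate-toℕ n) ⟩
  map suc (upTo n)          ≡⟨ map-upTo suc n ⟩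
  applyUpTo suc n           ∎)
  where open ≡-Reasoning

count-toℕ<-allFin : ∀ n h → count (λ (i : Fin n) → toℕ i <? h) (allFin n) ≡ h ⊓ n
count-toℕ<-allFin n h = begin
  count ((_<? h) ∘ toℕ) (allFin n)       ≡⟨ count-map (_<? h) toℕ (allFin n) ⟨
  count (_<? h) (map toℕ (allFin n))     ≡⟨ cong (count (_<? h)) (trans (map-tabulate id toℕ) (tabulate-toℕ n)) ⟩
  count (_<? h) (upTo n)                 ≡⟨ count-<-upTo h n ⟩
  h ⊓ n                                  ∎
  where open ≡-Reasoning

-- Adj n s u v unfolds to Jump n s (diff n u v).
Jump : ℕ → ℕ → ℕ → Set
Jump n s d = d ≡ 1 ⊎ d ≡ n ∸ 1 ⊎ d ≡ s ⊎ d ≡ n ∸ s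

jump? : ∀ n s d → Dec (Jump n s d)
jump? n s d = d ≟ 1 ⊎-dec d ≟ n ∸ 1 ⊎-dec d ≟ s ⊎-dec d ≟ n ∸ s

module _ {n s : ℕ} (1≤n : 1 ≤ n) (s≤n : s ≤ n) where

  Jump-∸ : ∀ {d} → Jump n s d → Jump n s (n ∸ d)
  Jump-∸ (inj₁ d≡1)                 = inj₂ (inj₁ (cong (n ∸_) d≡1))
  Jump-∸ (inj₂ (inj₁ d≡n∸1))        = inj₁ (trans (cong (n ∸_) d≡n∸1) (m∸[m∸n]≡n 1≤n))
  Jump-∸ (inj₂ (inj₂ (inj₁ d≡s)))   = inj₂ (inj₂ (inj₂ (cong (n ∸_) d≡s)))
  Jump-∸ (inj₂ (inj₂ (inj₂ d≡n∸s))) = inj₂ (inj₂ (inj₁ (trans (cong (n ∸_) d≡n∸s) (m∸[m∸n]≡n s≤n))))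

  Jump-∸⁻ : ∀ {d} → d ≤ n → Jump n s (n ∸ d) → Jump n s d
  Jump-∸⁻ d≤n jump = subst (Jump n s) (m∸[m∸n]≡n d≤n) (Jump-∸ jump)

diff-< : ∀ {n} {x y : Fin n} → toℕ x < toℕ y → diff n y x ≡ toℕ y ∸ toℕ x
diff-< {suc m} {x} {y} x<y = begin
  (v + (n ∸ u)) % n   ≡⟨ cong (_% n) (+-∸-assoc v (<⇒≤ (toℕ<n x))) ⟨
  (v + n ∸ u) % n     ≡⟨ cong (_% n) (+-∸-comm n (<⇒≤ x<y)) ⟩
  (v ∸ u + n) % n     ≡⟨ [m+n]%n≡m%n (v ∸ u) n ⟩
  (v ∸ u) % n         ≡⟨ m<n⇒m%n≡m (≤-<-trans (m∸n≤m v u) (toℕ<n y)) ⟩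
  v ∸ u               ∎
  where
  open ≡-Reasoning
  n = suc m
  u = toℕ x
  v = toℕ y

diff-> : ∀ {n} {x y : Fin n} → toℕ x < toℕ y → diff n x y ≡ n ∸ (toℕ y ∸ toℕ x)
diff-> {suc m} {x} {y} x<y = begin
  (u + (n ∸ v)) % n               ≡⟨ cong (_% n) (+-∸-assoc u (<⇒≤ (toℕ<n y))) ⟨
  (u + n ∸ v) % n                 ≡⟨ cong (λ w → (u + n ∸ w) % n) (m+[n∸m]≡n (<⇒≤ x<y)) ⟨
  (u + n ∸ (u + (v ∸ u))) % n     ≡⟨ cong (_% n) ([m+n]∸[m+o]≡n∸o u n (v ∸ u)) ⟩
  (n ∸ (v ∸ u)) % n               ≡⟨ m<n⇒m%n≡m (∸-monoʳ-< (m<n⇒0<n∸m x<y) (≤-trans (m∸n≤m v u) (<⇒≤ (toℕ<n y)))) ⟩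
  n ∸ (v ∸ u)                     ∎
  where
  open ≡-Reasoning
  n = suc m
  u = toℕ x
  v = toℕ y

module _ {n s : ℕ} (s≤n : s ≤ n) where

  Adj⇒Jump-gap : {x y : Fin n} → toℕ x < toℕ y → Adj n s x y → Jump n s (toℕ y ∸ toℕ x)
  Adj⇒Jump-gap {x} {y} x<y adj = Jump-∸⁻ 1≤n s≤n gap≤n (subst (Jump n s) (diff-> x<y) adj)
    where
    1≤n = ≤-trans (s≤s z≤n) (toℕ<n x)
    gap≤n = ≤-trans (m∸n≤m (toℕ y) (toℕ x)) (<⇒≤ (toℕ<n y))

  Adj-sym : (x y : Fin n) → Adj n s x y → Adj n s y x
  Adj-sym x y adj with <-cmp (toℕ x) (toℕ y)
  ... | tri< x<y _ _ = subst (Jump n s) (sym (diff-< x<y)) (Adj⇒Jump-gap x<y adj)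
  ... | tri≈ _ x≡y _ = subst₂ (Adj n s) (toℕ-injective x≡y) (sym (toℕ-injective x≡y)) adj
  ... | tri> _ _ y<x = subst (Jump n s) (sym (diff-> y<x)) (Jump-∸ 1≤n s≤n (subst (Jump n s) (diff-< y<x) adj))
    where 1≤n = ≤-trans (s≤s z≤n) (toℕ<n x)

≡-mod : ∀ {n} .{{_ : NonZero n}} (x : Fin n) {k} → toℕ x ≡ k → x ≡ k mod n
≡-mod {n} x {k} refl = toℕ-injective (sym (trans (toℕ-fromℕ< (m%n<n k n)) (m<n⇒m%n≡m (toℕ<n x))))

module _ (n s h : ℕ) .{{_ : NonZero n}} where

  edge : ℕ → ℕ → Fin n × Fin n
  edge k l = k mod n , l mod n

  s-edge-over-h : ℕ → Fin n × Fin n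
  s-edge-over-h i = edge (h + i ∸ s) (h + i)

  s-edge-over-0 : ℕ → Fin n × Fin n
  s-edge-over-0 i = edge i (i + (n ∸ s))

  cutCandidates : List (Fin n × Fin n)
  cutCandidates = edge 0 (n ∸ 1) ∷ edge (h ∸ 1) h ∷ map s-edge-over-h (upTo s) ++ map s-edge-over-0 (upTo s)

  length-cutCandidates : length cutCandidates ≡ 2 + (s + s)
  length-cutCandidates = cong (2 +_) (begin
    length (map s-edge-over-h (upTo s) ++ map s-edge-over-0 (upTo s))       ≡⟨ length-++ (map s-edge-over-h (upTo s)) ⟩
    length (map s-edge-over-h (upTo s)) + length (map s-edge-over-0 (upTo s)) ≡⟨ cong₂ _+_ (length-map s-edge-over-h (upTo s))
                                                                                            (length-map s-edge-over-0 (upTo s)) ⟩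
    length (upTo s) + length (upTo s)                                        ≡⟨ cong₂ _+_ (length-upTo s) (length-upTo s) ⟩
    s + s                                                                    ∎)
    where open ≡-Reasoning

  ∈-cutCandidates : s ≤ n → (a b : Fin n) → toℕ a < h → h ≤ toℕ b → Jump n s (toℕ b ∸ toℕ a) →
                    (a , b) ∈ cutCandidates
  ∈-cutCandidates s≤n a b a<h h≤b = cases
    where
    u = toℕ a
    v = toℕ b
    u+gap≡v : u + (v ∸ u) ≡ v
    u+gap≡v = m+[n∸m]≡n (<⇒≤ (<-≤-trans a<h h≤b))
    is-edge : ∀ {k l} → u ≡ k → v ≡ l → (a , b) ≡ edge k l
    is-edge u≡k v≡l = cong₂ _,_ (≡-mod a u≡k) (≡-mod b v≡l)
    cases : Jump n s (v ∸ u) → (a , b) ∈ cutCandidates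
    cases (inj₁ gap≡1) = there (here (is-edge (cong (_∸ 1) (trans (sym v≡1+u) v≡h)) v≡h))
      where
      v≡1+u : v ≡ suc u
      v≡1+u = trans (sym u+gap≡v) (trans (cong (u +_) gap≡1) (+-comm u 1))
      v≡h : v ≡ h
      v≡h = ≤-antisym (subst (_≤ h) (sym v≡1+u) a<h) h≤b
    cases (inj₂ (inj₁ gap≡n∸1)) = here (is-edge u≡0 (trans (sym u+gap≡v) (cong₂ _+_ u≡0 gap≡n∸1)))
      where
      u≡0 : u ≡ 0
      u≡0 = n<1⇒n≡0 (+-cancelʳ-< (n ∸ 1) u 1 (begin-strict
        u + (n ∸ 1)  ≡⟨ cong (u +_) gap≡n∸1 ⟨
        u + (v ∸ u)  ≡⟨ u+gap≡v ⟩
        v            <⟨ toℕ<n b ⟩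
        n            ≡⟨ m+[n∸m]≡n (>-nonZero⁻¹ n) ⟨
        1 + (n ∸ 1)  ∎))
        where open ≤-Reasoning
    cases (inj₂ (inj₂ (inj₁ gap≡s))) = subst (_∈ cutCandidates) (sym (is-edge u≡h+i∸s v≡h+i))
      (there (there (∈-++⁺ˡ (∈-map⁺ s-edge-over-h (∈-upTo⁺ i<s)))))
      where
      i = v ∸ h
      v≡h+i : v ≡ h + i
      v≡h+i = sym (m+[n∸m]≡n h≤b)
      u+s≡v : u + s ≡ v
      u+s≡v = trans (cong (u +_) (sym gap≡s)) u+gap≡v
      u≡h+i∸s : u ≡ h + i ∸ s
      u≡h+i∸s = trans (sym (m+n∸n≡m u s)) (cong (_∸ s) (trans u+s≡v v≡h+i))
      i<s : i < s
      i<s = +-cancelˡ-< h i s (subst (_< h + s) v≡h+i (subst (_< h + s) u+s≡v (+-monoˡ-< s a<h)))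
    cases (inj₂ (inj₂ (inj₂ gap≡n∸s))) = subst (_∈ cutCandidates) (sym (is-edge refl v≡u+[n∸s]))
      (there (there (∈-++⁺ʳ (map s-edge-over-h (upTo s)) (∈-map⁺ s-edge-over-0 (∈-upTo⁺ u<s)))))
      where
      v≡u+[n∸s] : v ≡ u + (n ∸ s)
      v≡u+[n∸s] = trans (sym u+gap≡v) (cong (u +_) gap≡n∸s)
      u<s : u < s
      u<s = +-cancelʳ-< (n ∸ s) u s (begin-strict
        u + (n ∸ s)  ≡⟨ v≡u+[n∸s] ⟨
        v            <⟨ toℕ<n b ⟩
        n            ≡⟨ m+[n∸m]≡n s≤n ⟨
        s + (n ∸ s)  ∎)
        where open ≤-Reasoning

steps-∷ : ∀ {n s u v y p} → Walk n s v y p → steps (u ∷ p) ≡ (u , v) ∷ steps p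
steps-∷ stop       = refl
steps-∷ (step _ _) = refl

walk-crosses : ∀ {n s} {P : Pred (Fin n) 0ℓ} (P? : Decidable P) {x y p} → Walk n s x y p → P x → ¬ P y →
               ∃₂ λ a b → Adj n s a b × P a × ¬ P b × (a , b) ∈ steps p
walk-crosses P? stop px ¬py = contradiction px ¬py
walk-crosses P? (step {u} {v} adj w) pu ¬py with P? v
... | no ¬pv = u , v , adj , pu , ¬pv , subst ((u , v) ∈_) (sym (steps-∷ w)) (here refl)
... | yes pv with walk-crosses P? w pv ¬py
...   | a , b , adj′ , pa , ¬pb , ab∈ = a , b , adj′ , pa , ¬pb , subst ((a , b) ∈_) (sym (steps-∷ w)) (there ab∈)

module _ (n h : ℕ) where

  Left : Pred (Fin n) 0ℓ
  Left i = toℕ i < h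

  left? : Decidable Left
  left? i = toℕ i <? h

  Crossing : Pred (Fin n × Fin n) 0ℓ
  Crossing = (Left ⟨×⟩ ∁ Left) ∪ (∁ Left ⟨×⟩ Left)

  crossing? : Decidable Crossing
  crossing? = (left? ×? ∁? left?) ∪? (∁? left? ×? left?)

  Crossing⇒≢ : ∀ {x y} → Crossing (x , y) → x ≢ y
  Crossing⇒≢ (inj₁ (x∈L , y∉L)) refl = y∉L x∈L
  Crossing⇒≢ (inj₂ (x∉L , y∈L)) refl = x∉L y∈L

  count-Crossing : h ≤ n → count crossing? (cartesianProduct (allFin n) (allFin n)) ≡ h * (n ∸ h) + (n ∸ h) * h
  count-Crossing h≤n = begin
    count crossing? (cartesianProduct V V)                                   ≡⟨ count-disjoint-∪ (left? ×? ∁? left?) (∁? left? ×? left?) disjoint (cartesianProduct V V) ⟩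
    count (left? ×? ∁? left?) (cartesianProduct V V)
      + count (∁? left? ×? left?) (cartesianProduct V V)                     ≡⟨ cong₂ _+_ (count-cartesianProduct left? (∁? left?) V V)
                                                                                          (count-cartesianProduct (∁? left?) left? V V) ⟩
    count left? V * count (∁? left?) V + count (∁? left?) V * count left? V ≡⟨ cong₂ (λ l r → l * r + r * l) |Left| |Right| ⟩
    h * (n ∸ h) + (n ∸ h) * h                                                ∎
    where
    open ≡-Reasoning
    V = allFin n
    disjoint : Empty ((Left ⟨×⟩ ∁ Left) ∩ (∁ Left ⟨×⟩ Left))
    disjoint _ ((x∈L , _) , (x∉L , _)) = x∉L x∈L
    |Left| : count left? V ≡ h
    |Left| = trans (count-toℕ<-allFin n h) (m≤n⇒m⊓n≡m h≤n)
    |Right| : count (∁? left?) V ≡ n ∸ h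
    |Right| = begin
      count (∁? left?) V                          ≡⟨ m+n∸m≡n h _ ⟨
      h + count (∁? left?) V ∸ h                  ≡⟨ cong (λ l → l + count (∁? left?) V ∸ h) |Left| ⟨
      count left? V + count (∁? left?) V ∸ h      ≡⟨ cong (_∸ h) (trans (count+count-∁ left? V) (length-tabulate id)) ⟩
      n ∸ h                                       ∎

module _ {n s : ℕ} .{{_ : NonZero n}} (s≤n : s ≤ n) (R : Routing n s) (h : ℕ) where

  adj? : (e : Fin n × Fin n) → Dec (Adj n s (proj₁ e) (proj₂ e))
  adj? (u , v) = jump? n s (diff n u v)

  cutEdges : List (Fin n × Fin n)
  cutEdges = filter adj? (cutCandidates n s h)

  Carries : Fin n × Fin n → Pred (Fin n × Fin n) 0ℓ
  Carries (u , v) (x , y) = x ≢ y × Uses u v (route R x y)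

  carries? : ∀ e → Decidable (Carries e)
  carries? (u , v) (x , y) = ¬? (x ≟F y) ×-dec uses? u v (route R x y)

  ∈-cutEdges : ∀ {a b} → Left n h a → ¬ Left n h b → Adj n s a b → (a , b) ∈ cutEdges
  ∈-cutEdges {a} {b} a<h b≮h adj = ∈-filter⁺ adj? (∈-cutCandidates n s h s≤n a b a<h h≤b gap) adj
    where
    h≤b = ≮⇒≥ b≮h
    gap = Adj⇒Jump-gap s≤n (<-≤-trans a<h h≤b) adj

  crossing-routed-through-cut : Crossing n h ⊆ (λ xy → Any (λ e → Carries e xy) cutEdges)
  crossing-routed-through-cut {x , y} crossing = through (proj₁ (valid R x y x≢y)) crossing
    where
    x≢y = Crossing⇒≢ n h crossing
    through : ∀ {p} → Walk n s x y p → Crossing n h (x , y) → Any (λ e → x ≢ y × Uses (proj₁ e) (proj₂ e) p) cutEdges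
    through walk (inj₁ (x∈L , y∉L)) with walk-crosses (left? n h) walk x∈L y∉L
    ... | a , b , adj , a∈L , b∉L , ab∈ = lose (∈-cutEdges a∈L b∉L adj) (x≢y , inj₁ ab∈)
    through walk (inj₂ (x∉L , y∈L)) with walk-crosses (∁? (left? n h)) walk x∉L (λ y∉L → y∉L y∈L)
    ... | a , b , adj , a∉L , ¬b∉L , ab∈ =
          lose (∈-cutEdges (decidable-stable (left? n h b) ¬b∉L) a∉L (Adj-sym s≤n a b adj)) (x≢y , inj₂ ab∈)

  cut-loads : Fin n × Fin n → ℕ
  cut-loads (u , v) = load R u v

  crossing≤sum-loads : h ≤ n → h * (n ∸ h) + (n ∸ h) * h ≤ sum (map cut-loads cutEdges)
  crossing≤sum-loads h≤n = begin
    h * (n ∸ h) + (n ∸ h) * h                                ≡⟨ count-Crossing n h h≤n ⟨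
    count (crossing? n h) pairs                              ≤⟨ count-mono (crossing? n h) _ crossing-routed-through-cut pairs ⟩
    count (λ xy → any? (λ e → carries? e xy) cutEdges) pairs ≤⟨ union-bound carries? cutEdges pairs ⟩
    sum (map cut-loads cutEdges)                             ∎
    where
    open ≤-Reasoning
    pairs = cartesianProduct (allFin n) (allFin n)

  |cutEdges|≤2+2s : length cutEdges ≤ 2 + (s + s)
  |cutEdges|≤2+2s = ≤-trans (length-filter adj? (cutCandidates n s h)) (≤-reflexive (length-cutCandidates n s h))

  cut-load : 0 < h → h < n → ∃₂ λ u v → Adj n s u v × h * (n ∸ h) ≤ (s + 1) * load R u v
  cut-load 0<h h<n = u , v , proj₂ (∈-filter⁻ adj? {xs = cutCandidates n s h} uv∈) , bound
    where
    c = n ∸ h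
    0<2hc : 0 < h * c + c * h
    0<2hc = ≤-trans (*-mono-≤ 0<h (m<n⇒0<n∸m h<n)) (m≤m+n (h * c) (c * h))
    heaviest = some-≥-average cut-loads cutEdges (<-≤-trans 0<2hc (crossing≤sum-loads (<⇒≤ h<n)))
    u = proj₁ (proj₁ heaviest)
    v = proj₂ (proj₁ heaviest)
    uv∈ = proj₁ (proj₂ heaviest)
    bound : h * c ≤ (s + 1) * load R u v
    bound = *-cancelˡ-≤ 2 (begin
      2 * (h * c)                       ≡⟨ cong (h * c +_) (trans (+-identityʳ (h * c)) (*-comm h c)) ⟩
      h * c + c * h                     ≤⟨ crossing≤sum-loads (<⇒≤ h<n) ⟩
      sum (map cut-loads cutEdges)      ≤⟨ proj₂ (proj₂ heaviest) ⟩
      length cutEdges * load R u v      ≤⟨ *-monoˡ-≤ (load R u v) |cutEdges|≤2+2s ⟩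
      (2 + (s + s)) * load R u v        ≡⟨ [2+s+s]*l≡2*[[s+1]*l] s (load R u v) ⟩
      2 * ((s + 1) * load R u v)        ∎)
      where
      open ≤-Reasoning
      [2+s+s]*l≡2*[[s+1]*l] : ∀ s l → (2 + (s + s)) * l ≡ 2 * ((s + 1) * l)
      [2+s+s]*l≡2*[[s+1]*l] = solve-∀

n/2≡⌊n/2⌋ : ∀ n → n / 2 ≡ ⌊ n /2⌋
n/2≡⌊n/2⌋ zero                = refl
n/2≡⌊n/2⌋ (suc zero)          = refl
n/2≡⌊n/2⌋ (suc (suc n))       = trans (+-distrib-/ 2 n (m%n<n n 2)) (cong suc (n/2≡⌊n/2⌋ n))

⌈n/2⌉≡⌊1+n/2⌋ : ∀ n → ⌈ n /2⌉ ≡ ⌊ suc n /2⌋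
⌈n/2⌉≡⌊1+n/2⌋ n = trans (cong (_/ 2) (+-comm n 1)) (n/2≡⌊n/2⌋ (suc n))

n∸n/2≡⌈n/2⌉ : ∀ n → n ∸ n / 2 ≡ ⌈ n /2⌉
n∸n/2≡⌈n/2⌉ n = begin
  n ∸ n / 2                        ≡⟨ cong (n ∸_) (n/2≡⌊n/2⌋ n) ⟩
  n ∸ ⌊ n /2⌋                      ≡⟨ cong (_∸ ⌊ n /2⌋) (⌊n/2⌋+⌈n/2⌉≡n n) ⟨
  ⌊ n /2⌋ + ⌊ suc n /2⌋ ∸ ⌊ n /2⌋  ≡⟨ m+n∸m≡n ⌊ n /2⌋ ⌊ suc n /2⌋ ⟩
  ⌊ suc n /2⌋                      ≡⟨ ⌈n/2⌉≡⌊1+n/2⌋ n ⟨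
  ⌈ n /2⌉                          ∎
  where open ≡-Reasoning

4*⌊n/2⌋*⌈n/2⌉+n%2≡n*n : ∀ n → 4 * (⌊ n /2⌋ * ⌊ suc n /2⌋) + n % 2 ≡ n * n
4*⌊n/2⌋*⌈n/2⌉+n%2≡n*n zero          = refl
4*⌊n/2⌋*⌈n/2⌉+n%2≡n*n (suc zero)    = refl
4*⌊n/2⌋*⌈n/2⌉+n%2≡n*n (suc (suc n)) = begin
  4 * (suc f * suc c) + n % 2              ≡⟨ expand f c (n % 2) ⟩
  (4 * (f * c) + n % 2) + 4 * (f + c) + 4  ≡⟨ cong₂ (λ a b → a + 4 * b + 4) (4*⌊n/2⌋*⌈n/2⌉+n%2≡n*n n) (⌊n/2⌋+⌈n/2⌉≡n n) ⟩
  n * n + 4 * n + 4                        ≡⟨ square n ⟩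
  suc (suc n) * suc (suc n)                ∎
  where
  open ≡-Reasoning
  f = ⌊ n /2⌋
  c = ⌊ suc n /2⌋
  expand : ∀ f c r → 4 * (suc f * suc c) + r ≡ (4 * (f * c) + r) + 4 * (f + c) + 4
  expand = solve-∀
  square : ∀ n → n * n + 4 * n + 4 ≡ suc (suc n) * suc (suc n)
  square = solve-∀

lemma2p1 : (n s : ℕ) → 5 ≤ n → 1 < s → 2 * s < n →
    ((R : Routing n s) → ∃₂ λ (u v : Fin n) → Adj n s u v × ((n / 2) * ⌈ n /2⌉ ≤ (s + 1) * load R u v))
    × (4 * ((n / 2) * ⌈ n /2⌉) + ε n ≡ n * n)
lemma2p1 n@(suc _) s 5≤n _ 2s<n = load-bound , halves-identity
  where
  s≤n : s ≤ n
  s≤n = ≤-trans (m≤m+n s (s + 0)) (<⇒≤ 2s<n)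
  load-bound : (R : Routing n s) → ∃₂ λ u v → Adj n s u v × n / 2 * ⌈ n /2⌉ ≤ (s + 1) * load R u v
  load-bound R =
    let u , v , adj , bound = cut-load s≤n R (n / 2) (m≥n⇒m/n>0 (≤-trans (s≤s (s≤s z≤n)) 5≤n)) (m/n<m n 2 (s≤s (s≤s z≤n)))
    in  u , v , adj , subst (λ c → n / 2 * c ≤ (s + 1) * load R u v) (n∸n/2≡⌈n/2⌉ n) bound
  halves-identity : 4 * (n / 2 * ⌈ n /2⌉) + ε n ≡ n * n
  halves-identity = trans (cong₂ (λ f c → 4 * (f * c) + n % 2) (n/2≡⌊n/2⌋ n) (⌈n/2⌉≡⌊1+n/2⌋ n)) (4*⌊n/2⌋*⌈n/2⌉+n%2≡n*n n)
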